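{- Let $k$ be a positive integer with $\gcd(k,6)=1$. (i) If $\ell\ge 3$ and $r=2^\ell k$, then $r$ is distinguished with respect to $(3,1)$ if and only if $2^{\ell-1}$ divides $\operatorname{ord}_k(3)$. (ii) If $r=2k$, then $r$ is distinguished with respect to $(3,1)$ if and only if $2$ divides $\operatorname{ord}_k(3)$. (iii) If $r=4k$, then $r$ is distinguished with respect to $(3,1)$.
   Context: For integers $s$ and $r\ge 1$ with $\gcd(r,s)=1$, $\operatorname{ord}_r(s)$ denotes the least positive integer $m$ with $s^m\equiv 1\pmod r$. An integer $r\ge 2$ is distinguished with respect to $(3,1)$ if $\gcd(r,3)=1$ and $r$ divides $\frac{3^{\operatorname{ord}_r(3)}-1}{3-1}$. -}

module Defs where

open import Data.Nat using (ℕ; _∸_; _^_; _<_; _≤_; _/_)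
open import Data.Nat.Divisibility using (_∣_)
open import Data.Nat.Coprimality using (Coprime)
open import Data.Product using (Σ; _×_)

-- 1 ≤ m, s^m ≡ 1 (mod r) (written r ∣ s^m ∸ 1; we only use s ≥ 1)
PowOne : ℕ → ℕ → ℕ → Set
PowOne r s m = 1 ≤ m × r ∣ s ^ m ∸ 1

IsOrd : ℕ → ℕ → ℕ → Set
IsOrd r s m = PowOne r s m × (∀ m′ → PowOne r s m′ → m ≤ m′)

-- r is distinguished with respect to (3,1):
-- gcd(r,3)=1 and r ∣ (3^{ord_r 3} - 1)/(3 - 1)
Distinguished31 : ℕ → Set
Distinguished31 r = Coprime r 3 × Σ ℕ (λ m → IsOrd r 3 m × r ∣ (3 ^ m ∸ 1) / 2)

-- Let r = 2^ℓ k with k odd and o = ord_k(3).  Since k is odd, 2^ℓ k ∣ 3^n − 1 iff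
-- 2^ℓ ∣ 3^n − 1 and o ∣ n.  Lifting the exponent, 3^(2^(e+1)) − 1 = 2^(e+3) · odd
-- (by induction from 3^(2n) − 1 = (3^n − 1)(3^n + 1)), so for ℓ ≥ 3 the condition
-- 2^ℓ ∣ 3^n − 1 reads 2^(ℓ−2) ∣ n.  Hence ord_r(3) = L := lcm(2^(ℓ−2), o), and r is
-- distinguished iff 2^(ℓ+1) ∣ 3^L − 1, i.e. 2^(ℓ−1) ∣ L, which happens iff
-- 2^(ℓ−1) ∣ o (otherwise L/2 would already be a common multiple).  For ℓ = 1 the
-- same argument runs with ord_2(3) = 1.  For ℓ = 2 the order lcm(2, o) is even, and
-- 8 ∣ 3^n − 1 as soon as n is even, so 4k is always distinguished.

{-# OPTIONS --safe #-}
module Submission where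

open import Defs
open import Data.Nat using (ℕ; zero; suc; _+_; _*_; _^_; _∸_; _≤_; _≥_; z≤n; s≤s; NonZero; >-nonZero; >-nonZero⁻¹; ≢-nonZero; ≢-nonZero⁻¹; nonTrivial⇒≢1)
open import Data.Nat.Properties
open import Data.Nat.Divisibility
open import Data.Nat.DivMod using (_/_; _%_; m≡m%n+[m/n]*n; m%n<n)
open import Data.Nat.Coprimality using (Coprime)
open import Data.Nat.LCM using (lcm; m∣lcm[m,n]; n∣lcm[m,n]; lcm-least; gcd*lcm)
open import Data.Nat.GCD using (gcd)
open import Data.Nat.Primality using (Prime; prime?; prime[2]; euclidsLemma; prime⇒irreducible; prime⇒nonZero; prime⇒nonTrivial)
open import Data.Nat.Tactic.RingSolver using (solve-∀)
open import Data.Product using (∃-syntax; _×_; _,_; proj₁; proj₂)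
open import Data.Sum using (inj₁; inj₂)
open import Function.Base using (_∘_)
open import Function.Bundles using (_⇔_; mk⇔; Equivalence)
open import Function.Properties.Equivalence using () renaming (sym to ⇔-sym)
open import Function.Related.Propositional using (module EquationalReasoning)
open import Data.Product.Function.NonDependent.Propositional using (_×-⇔_)
open import Relation.Nullary using (¬_; contradiction; yes; no)
open import Relation.Nullary.Decidable using (from-yes; from-no)
open import Relation.Binary.PropositionalEquality

2∤⇒odd : ∀ c → ¬ 2 ∣ c → ∃[ t ] c ≡ 1 + t * 2
2∤⇒odd zero          2∤c = contradiction (2 ∣0) 2∤c
2∤⇒odd (suc zero)    _   = 0 , refl
2∤⇒odd (suc (suc c)) 2∤c with 2∤⇒odd c (2∤c ∘ ∣m∣n⇒∣m+n ∣-refl)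
... | t , refl = suc t , refl

lcm∣⇔∣×∣ : ∀ {m n c} → lcm m n ∣ c ⇔ (m ∣ c × n ∣ c)
lcm∣⇔∣×∣ {m} {n} = mk⇔
  (λ lcm∣c → ∣-trans (m∣lcm[m,n] m n) lcm∣c , ∣-trans (n∣lcm[m,n] m n) lcm∣c)
  (λ (m∣c , n∣c) → lcm-least m∣c n∣c)

lcm≢0 : ∀ m n .{{_ : NonZero m}} .{{_ : NonZero n}} → NonZero (lcm m n)
lcm≢0 m n = ≢-nonZero λ lcm≡0 → ≢-nonZero⁻¹ (m * n) {{m*n≢0 m n}} (begin
  m * n                 ≡⟨ gcd*lcm m n ⟨
  gcd m n * lcm m n     ≡⟨ cong (gcd m n *_) lcm≡0 ⟩
  gcd m n * 0           ≡⟨ *-zeroʳ (gcd m n) ⟩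
  0                     ∎)
  where open ≡-Reasoning

module _ {p : ℕ} (p-prime : Prime p) where

  private instance
    p≢0 : NonZero p
    p≢0 = prime⇒nonZero p-prime

  p∤1 : ¬ p ∣ 1
  p∤1 = nonTrivial⇒≢1 {{prime⇒nonTrivial p-prime}} ∘ ∣1⇒≡1

  ∤⇒coprime : ∀ {n} → ¬ p ∣ n → Coprime n p
  ∤⇒coprime p∤n (d∣n , d∣p) with prime⇒irreducible p-prime d∣p
  ... | inj₁ d≡1 = d≡1
  ... | inj₂ refl = contradiction d∣n p∤n

  ∤⇒∤^ : ∀ {m} → ¬ p ∣ m → ∀ n → ¬ p ∣ m ^ n
  ∤⇒∤^ p∤m zero    = p∤1
  ∤⇒∤^ {m} p∤m (suc n) p∣m^[1+n] with euclidsLemma m (m ^ n) p-prime p∣m^[1+n]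
  ... | inj₁ p∣m   = p∤m p∣m
  ... | inj₂ p∣m^n = ∤⇒∤^ p∤m n p∣m^n

  ^∣*⇒^∣ : ∀ {m} → ¬ p ∣ m → ∀ a {n} → p ^ a ∣ m * n → p ^ a ∣ n
  ^∣*⇒^∣ p∤m zero    {n} _ = 1∣ n
  ^∣*⇒^∣ {m} p∤m (suc a) {n} p^[1+a]∣m*n
    with euclidsLemma m n p-prime (∣-trans (m∣m*n (p ^ a)) p^[1+a]∣m*n)
  ... | inj₁ p∣m = contradiction p∣m p∤m
  ... | inj₂ (divides-refl n′) =
    subst (_∣ n′ * p) (*-comm (p ^ a) p) (*-monoˡ-∣ p (^∣*⇒^∣ p∤m a p^a∣m*n′))
    where
    shuffle : ∀ m n′ p → m * (n′ * p) ≡ p * (m * n′)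
    shuffle = solve-∀
    p^a∣m*n′ : p ^ a ∣ m * n′
    p^a∣m*n′ = *-cancelˡ-∣ p (subst (p ^ suc a ∣_) (shuffle m n′ p) p^[1+a]∣m*n)

  ^*∣⇔∣×∣ : ∀ {m} → ¬ p ∣ m → ∀ a {n} → p ^ a * m ∣ n ⇔ (p ^ a ∣ n × m ∣ n)
  ^*∣⇔∣×∣ {m} p∤m a = mk⇔
    (λ p^a*m∣n → m*n∣⇒m∣ (p ^ a) m p^a*m∣n , m*n∣⇒n∣ (p ^ a) m p^a*m∣n)
    (λ { (p^a∣n , divides-refl q) →
      *-monoˡ-∣ m (^∣*⇒^∣ p∤m a (subst (p ^ a ∣_) (*-comm q m) p^a∣n)) })

  ^[1+a]∣lcm[^a,n]⇔^[1+a]∣n : ∀ a {n} .{{_ : NonZero n}} →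
                               p ^ suc a ∣ lcm (p ^ a) n ⇔ p ^ suc a ∣ n
  ^[1+a]∣lcm[^a,n]⇔^[1+a]∣n a {n} =
    mk⇔ to (λ p^[1+a]∣n → ∣-trans p^[1+a]∣n (n∣lcm[m,n] (p ^ a) n))
    where
    instance
      p^a≢0 : NonZero (p ^ a)
      p^a≢0 = m^n≢0 p a
    L = lcm (p ^ a) n
    to : p ^ suc a ∣ L → p ^ suc a ∣ n
    to p^[1+a]∣L with n∣lcm[m,n] (p ^ a) n
    ... | divides c L≡c*n with p ∣? c
    ...   | no p∤c = ^∣*⇒^∣ p∤c (suc a) (subst (p ^ suc a ∣_) L≡c*n p^[1+a]∣L)
    ...   | yes (divides t c≡t*p) = contradiction p∣1 p∤1
      where
      L′ = t * n
      L≡p*L′ : L ≡ p * L′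
      L≡p*L′ = trans L≡c*n (trans (cong (_* n) c≡t*p) (shuffle t p n))
        where
        shuffle : ∀ t p n → t * p * n ≡ p * (t * n)
        shuffle = solve-∀
      instance
        L′≢0 : NonZero L′
        L′≢0 = m*n≢0⇒n≢0 p {{subst NonZero L≡p*L′ (lcm≢0 (p ^ a) n)}}
      L∣L′ : L ∣ L′
      L∣L′ = lcm-least (*-cancelˡ-∣ p (subst (p ^ suc a ∣_) L≡p*L′ p^[1+a]∣L)) (n∣m*n t)
      p∣1 : p ∣ 1
      p∣1 = *-cancelʳ-∣ L′ (subst₂ _∣_ L≡p*L′ (sym (*-identityˡ L′)) L∣L′)

module PowerMinusOne (b : ℕ) .{{_ : NonZero b}} where

  1+[b^n∸1]≡b^n : ∀ n → 1 + (b ^ n ∸ 1) ≡ b ^ n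
  1+[b^n∸1]≡b^n n = m+[n∸m]≡n (m^n>0 b n)

  ^∸1-+ : ∀ m n → b ^ (m + n) ∸ 1 ≡ b ^ n * (b ^ m ∸ 1) + (b ^ n ∸ 1)
  ^∸1-+ m n = suc-injective (begin
    1 + (b ^ (m + n) ∸ 1)  ≡⟨ 1+[b^n∸1]≡b^n (m + n) ⟩
    b ^ (m + n)            ≡⟨ ^-distribˡ-+-* b m n ⟩
    b ^ m * b ^ n          ≡⟨ cong₂ _*_ (1+[b^n∸1]≡b^n m) (1+[b^n∸1]≡b^n n) ⟨
    (1 + u) * (1 + v)      ≡⟨ expand u v ⟩
    1 + ((1 + v) * u + v)  ≡⟨ cong (λ x → 1 + (x * u + v)) (1+[b^n∸1]≡b^n n) ⟩
    1 + (b ^ n * u + v)    ∎)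
    where
    open ≡-Reasoning
    u = b ^ m ∸ 1
    v = b ^ n ∸ 1
    expand : ∀ x y → (1 + x) * (1 + y) ≡ 1 + ((1 + y) * x + y)
    expand = solve-∀

  ^∸1-2* : ∀ n → b ^ (2 * n) ∸ 1 ≡ (b ^ n ∸ 1) * (b ^ n ∸ 1 + 2)
  ^∸1-2* n = begin
    b ^ (2 * n) ∸ 1        ≡⟨ cong (λ m → b ^ (n + m) ∸ 1) (+-identityʳ n) ⟩
    b ^ (n + n) ∸ 1        ≡⟨ ^∸1-+ n n ⟩
    b ^ n * u + u          ≡⟨ cong (λ x → x * u + u) (1+[b^n∸1]≡b^n n) ⟨
    (1 + u) * u + u        ≡⟨ factor u ⟩
    u * (u + 2)            ∎
    where
    open ≡-Reasoning
    u = b ^ n ∸ 1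
    factor : ∀ x → (1 + x) * x + x ≡ x * (x + 2)
    factor = solve-∀

  ∣^∸1⇒∣^[*]∸1 : ∀ {r m} c → r ∣ b ^ m ∸ 1 → r ∣ b ^ (c * m) ∸ 1
  ∣^∸1⇒∣^[*]∸1 zero    r∣ = _ ∣0
  ∣^∸1⇒∣^[*]∸1 {r} {m} (suc c) r∣ = subst (r ∣_) (sym (^∸1-+ m (c * m)))
    (∣m∣n⇒∣m+n (∣n⇒∣m*n (b ^ (c * m)) r∣) (∣^∸1⇒∣^[*]∸1 c r∣))

  ∣^∸1⇒∣^∸1 : ∀ {r m n} → r ∣ b ^ m ∸ 1 → m ∣ n → r ∣ b ^ n ∸ 1
  ∣^∸1⇒∣^∸1 r∣ (divides-refl c) = ∣^∸1⇒∣^[*]∸1 c r∣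

  ∣^∸1-cancel : ∀ {r} m n → r ∣ b ^ (m + n) ∸ 1 → r ∣ b ^ m ∸ 1 → r ∣ b ^ n ∸ 1
  ∣^∸1-cancel {r} m n r∣+ r∣m =
    ∣m+n∣m⇒∣n (subst (r ∣_) (^∸1-+ m n) r∣+) (∣n⇒∣m*n (b ^ n) r∣m)

  ∣^[2*m]∸1⇒2*m∣ : ∀ {r m n} → r ∣ b ^ (2 * m) ∸ 1 → ¬ r ∣ b ^ m ∸ 1 →
                    r ∣ b ^ n ∸ 1 → m ∣ n → 2 * m ∣ n
  ∣^[2*m]∸1⇒2*m∣ {r} {m} r∣2m r∤m r∣n (divides-refl c) with 2 ∣? c
  ... | yes (divides-refl t) = divides t (*-assoc t 2 m)
  ... | no 2∤c with 2∤⇒odd c 2∤c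
  ...   | t , refl = contradiction r∣m r∤m
    where
    odd-multiple : ∀ t m → (1 + t * 2) * m ≡ t * (2 * m) + m
    odd-multiple = solve-∀
    r∣m : r ∣ b ^ m ∸ 1
    r∣m = ∣^∸1-cancel (t * (2 * m)) m
            (subst (λ n → r ∣ b ^ n ∸ 1) (odd-multiple t m) r∣n) (∣^∸1⇒∣^[*]∸1 t r∣2m)

  isOrd⇒∣ : ∀ {r o n} → IsOrd r b o → r ∣ b ^ n ∸ 1 → o ∣ n
  isOrd⇒∣ {r} {o@(suc _)} {n} ((_ , r∣o) , least) r∣n = m%n≡0⇒n∣m n o n%o≡0
    where
    n≡q*o+n%o : n ≡ n / o * o + n % o
    n≡q*o+n%o = trans (m≡m%n+[m/n]*n n o) (+-comm (n % o) _)
    r∣rem : r ∣ b ^ (n % o) ∸ 1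
    r∣rem = ∣^∸1-cancel (n / o * o) (n % o)
              (subst (λ x → r ∣ b ^ x ∸ 1) n≡q*o+n%o r∣n) (∣^∸1⇒∣^[*]∸1 (n / o) r∣o)
    n%o≡0 : n % o ≡ 0
    n%o≡0 = n<1⇒n≡0 (≰⇒> λ 1≤rem → <⇒≱ (m%n<n n o) (least (n % o) (1≤rem , r∣rem)))

  isOrd⇒∣⇔∣ : ∀ {r o} → IsOrd r b o → ∀ n → r ∣ b ^ n ∸ 1 ⇔ o ∣ n
  isOrd⇒∣⇔∣ ord@((_ , r∣o) , _) n = mk⇔ (isOrd⇒∣ ord) (∣^∸1⇒∣^∸1 r∣o)

  ∣⇔∣⇒isOrd : ∀ {r L} → 1 ≤ L → (∀ n → r ∣ b ^ n ∸ 1 ⇔ L ∣ n) → IsOrd r b L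
  ∣⇔∣⇒isOrd {L = L} 1≤L r∣⇔L∣ =
    (1≤L , Equivalence.from (r∣⇔L∣ L) ∣-refl) ,
    λ m (1≤m , r∣m) → ∣⇒≤ {{>-nonZero 1≤m}} (Equivalence.to (r∣⇔L∣ m) r∣m)

  isOrd-unique : ∀ {r m n} → IsOrd r b m → IsOrd r b n → m ≡ n
  isOrd-unique (pm , least-m) (pn , least-n) = ≤-antisym (least-m _ pn) (least-n _ pm)

open PowerMinusOne 3

3^2^[1+e]∸1≡2^[3+e]*odd : ∀ e → ∃[ u ] (¬ 2 ∣ u × 3 ^ (2 ^ suc e) ∸ 1 ≡ 2 ^ (3 + e) * u)
3^2^[1+e]∸1≡2^[3+e]*odd zero = 1 , p∤1 prime[2] , refl
3^2^[1+e]∸1≡2^[3+e]*odd (suc e) with 3^2^[1+e]∸1≡2^[3+e]*odd e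
... | u , 2∤u , D≡2^[3+e]*u = u * (x * u + 1) , 2∤u′ , (begin
  3 ^ (2 * 2 ^ suc e) ∸ 1                     ≡⟨ ^∸1-2* (2 ^ suc e) ⟩
  D * (D + 2)                                 ≡⟨ cong (λ d → d * (d + 2)) D≡2^[3+e]*u ⟩
  (2 * x * u) * (2 * x * u + 2)               ≡⟨ regroup x u ⟩
  2 * (2 * x) * (u * (x * u + 1))             ∎)
  where
  open ≡-Reasoning
  x = 2 ^ (2 + e)
  D = 3 ^ (2 ^ suc e) ∸ 1
  regroup : ∀ x u → (2 * x * u) * (2 * x * u + 2) ≡ 2 * (2 * x) * (u * (x * u + 1))
  regroup = solve-∀
  2∤u′ : ¬ 2 ∣ u * (x * u + 1)
  2∤u′ 2∣u′ with euclidsLemma u (x * u + 1) prime[2] 2∣u′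
  ... | inj₁ 2∣u  = 2∤u 2∣u
  ... | inj₂ 2∣xu+1 = p∤1 prime[2] (∣m+n∣m⇒∣n 2∣xu+1 (∣m⇒∣m*n u (m∣m*n (2 ^ suc e))))

2^[3+e]∣3^2^[1+e]∸1 : ∀ e → 2 ^ (3 + e) ∣ 3 ^ (2 ^ suc e) ∸ 1
2^[3+e]∣3^2^[1+e]∸1 e with 3^2^[1+e]∸1≡2^[3+e]*odd e
... | u , _ , D≡2^[3+e]*u = divides u (trans D≡2^[3+e]*u (*-comm (2 ^ (3 + e)) u))

2^[3+e]∤3^2^e∸1 : ∀ e → ¬ 2 ^ (3 + e) ∣ 3 ^ (2 ^ e) ∸ 1
2^[3+e]∤3^2^e∸1 zero = from-no (8 ∣? 2)
2^[3+e]∤3^2^e∸1 (suc e) 2^[4+e]∣D with 3^2^[1+e]∸1≡2^[3+e]*odd e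
... | u , 2∤u , D≡2^[3+e]*u = 2∤u (*-cancelˡ-∣ (2 ^ (3 + e)) {{m^n≢0 2 (3 + e)}}
        (subst₂ _∣_ (*-comm 2 (2 ^ (3 + e))) D≡2^[3+e]*u 2^[4+e]∣D))

2^[2+e]∣3^n∸1⇒2^e∣n : ∀ e {n} → 2 ^ (2 + e) ∣ 3 ^ n ∸ 1 → 2 ^ e ∣ n
2^[2+e]∣3^n∸1⇒2^e∣n zero    {n} _       = 1∣ n
2^[2+e]∣3^n∸1⇒2^e∣n (suc e) 2^[3+e]∣D =
  ∣^[2*m]∸1⇒2*m∣ (2^[3+e]∣3^2^[1+e]∸1 e) (2^[3+e]∤3^2^e∸1 e) 2^[3+e]∣D
    (2^[2+e]∣3^n∸1⇒2^e∣n e (∣-trans (n∣m*n 2) 2^[3+e]∣D))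

2^[3+e]∣3^n∸1⇔2^[1+e]∣n : ∀ e n → 2 ^ (3 + e) ∣ 3 ^ n ∸ 1 ⇔ 2 ^ suc e ∣ n
2^[3+e]∣3^n∸1⇔2^[1+e]∣n e n =
  mk⇔ (2^[2+e]∣3^n∸1⇒2^e∣n (suc e)) (∣^∸1⇒∣^∸1 (2^[3+e]∣3^2^[1+e]∸1 e))

4∣3^n∸1⇔2∣n : ∀ n → 4 ∣ 3 ^ n ∸ 1 ⇔ 2 ∣ n
4∣3^n∸1⇔2∣n n = mk⇔
  (λ 4∣D → ∣^[2*m]∸1⇒2*m∣ (divides 2 refl) (from-no (4 ∣? 2)) 4∣D (1∣ n))
  (∣^∸1⇒∣^∸1 (divides 2 refl))

2∣3^n∸1⇔1∣n : ∀ n → 2 ∣ 3 ^ n ∸ 1 ⇔ 1 ∣ n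
2∣3^n∸1⇔1∣n n = mk⇔ (λ _ → 1∣ n) (∣^∸1⇒∣^∸1 ∣-refl)

distinguished31⇔2*r∣3^ord∸1 : ∀ {r m} → Coprime r 3 → IsOrd r 3 m →
                              Distinguished31 r ⇔ 2 * r ∣ 3 ^ m ∸ 1
distinguished31⇔2*r∣3^ord∸1 {r} {m} r⊥3 ord = mk⇔
  (λ { (_ , m′ , ord′ , r∣half) → subst (λ n → 2 * r ∣ 3 ^ n ∸ 1) (isOrd-unique ord′ ord)
         (m∣n/o⇒o*m∣n (Equivalence.from (2∣3^n∸1⇔1∣n m′) (1∣ m′)) r∣half) })
  (λ 2r∣D → (λ {_} → r⊥3) , m , ord , m*n∣o⇒n∣o/m 2 r 2r∣D)

coprime[k,6]⇒2∤k : ∀ {k} → Coprime k 6 → ¬ 2 ∣ k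
coprime[k,6]⇒2∤k k⊥6 2∣k with k⊥6 (2∣k , divides 3 refl)
... | ()

coprime[k,6]⇒coprime[2^ℓ*k,3] : ∀ ℓ {k} → Coprime k 6 → Coprime (2 ^ ℓ * k) 3
coprime[k,6]⇒coprime[2^ℓ*k,3] ℓ {k} k⊥6 = ∤⇒coprime prime[3] 3∤2^ℓ*k
  where
  prime[3] : Prime 3
  prime[3] = from-yes (prime? 3)
  3∤2^ℓ*k : ¬ 3 ∣ 2 ^ ℓ * k
  3∤2^ℓ*k 3∣2^ℓ*k with euclidsLemma (2 ^ ℓ) k prime[3] 3∣2^ℓ*k
  ... | inj₁ 3∣2^ℓ = ∤⇒∤^ prime[3] (from-no (3 ∣? 2)) ℓ 3∣2^ℓ
  ... | inj₂ 3∣k with k⊥6 (3∣k , divides 2 refl)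
  ...   | ()

module _ {k o : ℕ} (k⊥6 : Coprime k 6) (ord : IsOrd k 3 o) where

  private instance
    o≢0 : NonZero o
    o≢0 = >-nonZero (proj₁ (proj₁ ord))

  isOrd[2^ℓ*k]-lcm : ∀ ℓ β → (∀ n → 2 ^ ℓ ∣ 3 ^ n ∸ 1 ⇔ 2 ^ β ∣ n) →
                     IsOrd (2 ^ ℓ * k) 3 (lcm (2 ^ β) o)
  isOrd[2^ℓ*k]-lcm ℓ β 2^ℓ∣⇔2^β∣ =
    ∣⇔∣⇒isOrd (>-nonZero⁻¹ L {{lcm≢0 (2 ^ β) o {{m^n≢0 2 β}}}}) λ n →
    2 ^ ℓ * k ∣ 3 ^ n ∸ 1                    ∼⟨ ^*∣⇔∣×∣ prime[2] (coprime[k,6]⇒2∤k k⊥6) ℓ ⟩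
    (2 ^ ℓ ∣ 3 ^ n ∸ 1 × k ∣ 3 ^ n ∸ 1)      ∼⟨ 2^ℓ∣⇔2^β∣ n ×-⇔ isOrd⇒∣⇔∣ ord n ⟩
    (2 ^ β ∣ n × o ∣ n)                      ∼⟨ ⇔-sym lcm∣⇔∣×∣ ⟩
    L ∣ n                                    ∎
    where
    open EquationalReasoning
    L = lcm (2 ^ β) o

  distinguished31[2^ℓ*k]⇔ : ∀ ℓ β → (∀ n → 2 ^ ℓ ∣ 3 ^ n ∸ 1 ⇔ 2 ^ β ∣ n) →
                            Distinguished31 (2 ^ ℓ * k) ⇔ 2 ^ suc ℓ ∣ 3 ^ lcm (2 ^ β) o ∸ 1
  distinguished31[2^ℓ*k]⇔ ℓ β 2^ℓ∣⇔2^β∣ =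
    Distinguished31 (2 ^ ℓ * k)                  ∼⟨ distinguished31⇔2*r∣3^ord∸1
                                                      (coprime[k,6]⇒coprime[2^ℓ*k,3] ℓ k⊥6)
                                                      (isOrd[2^ℓ*k]-lcm ℓ β 2^ℓ∣⇔2^β∣) ⟩
    2 * (2 ^ ℓ * k) ∣ 3 ^ L ∸ 1                  ≡⟨ cong (_∣ 3 ^ L ∸ 1) (*-assoc 2 (2 ^ ℓ) k) ⟨
    2 ^ suc ℓ * k ∣ 3 ^ L ∸ 1                    ∼⟨ ^*∣⇔∣×∣ prime[2] (coprime[k,6]⇒2∤k k⊥6) (suc ℓ) ⟩
    (2 ^ suc ℓ ∣ 3 ^ L ∸ 1 × k ∣ 3 ^ L ∸ 1)      ∼⟨ mk⇔ proj₁ (_, k∣3^L∸1) ⟩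
    2 ^ suc ℓ ∣ 3 ^ L ∸ 1                        ∎
    where
    open EquationalReasoning
    L = lcm (2 ^ β) o
    k∣3^L∸1 : k ∣ 3 ^ L ∸ 1
    k∣3^L∸1 = ∣^∸1⇒∣^∸1 (proj₂ (proj₁ ord)) (n∣lcm[m,n] (2 ^ β) o)

lemma2p4 : ∀ (k : ℕ) → k ≥ 1 → Coprime k 6 → ∀ (o : ℕ) → IsOrd k 3 o →
    ((∀ (ℓ : ℕ) → ℓ ≥ 3 → (Distinguished31 (2 ^ ℓ * k) ⇔ (2 ^ (ℓ ∸ 1) ∣ o)))
    × (Distinguished31 (2 * k) ⇔ (2 ∣ o))
    × Distinguished31 (4 * k))
lemma2p4 k _ k⊥6 o ord = part-i , part-ii , part-iii
  where
  open EquationalReasoning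
  instance
    o≢0 : NonZero o
    o≢0 = >-nonZero (proj₁ (proj₁ ord))
  part-i : ∀ ℓ → ℓ ≥ 3 → Distinguished31 (2 ^ ℓ * k) ⇔ 2 ^ (ℓ ∸ 1) ∣ o
  part-i ℓ@(suc (suc (suc e))) (s≤s (s≤s (s≤s z≤n))) =
    Distinguished31 (2 ^ ℓ * k)            ∼⟨ distinguished31[2^ℓ*k]⇔ k⊥6 ord ℓ (suc e)
                                                (2^[3+e]∣3^n∸1⇔2^[1+e]∣n e) ⟩
    2 ^ suc ℓ ∣ 3 ^ lcm (2 ^ suc e) o ∸ 1  ∼⟨ 2^[3+e]∣3^n∸1⇔2^[1+e]∣n (suc e) _ ⟩
    2 ^ (2 + e) ∣ lcm (2 ^ suc e) o        ∼⟨ ^[1+a]∣lcm[^a,n]⇔^[1+a]∣n prime[2] (suc e) ⟩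
    2 ^ (2 + e) ∣ o                        ∎
  part-ii : Distinguished31 (2 * k) ⇔ 2 ∣ o
  part-ii =
    Distinguished31 (2 * k)    ∼⟨ distinguished31[2^ℓ*k]⇔ k⊥6 ord 1 0 2∣3^n∸1⇔1∣n ⟩
    4 ∣ 3 ^ lcm 1 o ∸ 1        ∼⟨ 4∣3^n∸1⇔2∣n _ ⟩
    2 ∣ lcm 1 o                ∼⟨ ^[1+a]∣lcm[^a,n]⇔^[1+a]∣n prime[2] 0 ⟩
    2 ∣ o                      ∎
  part-iii : Distinguished31 (4 * k)
  part-iii = Equivalence.from (distinguished31[2^ℓ*k]⇔ k⊥6 ord 2 1 4∣3^n∸1⇔2∣n)
               (Equivalence.from (2^[3+e]∣3^n∸1⇔2^[1+e]∣n 0 _) (m∣lcm[m,n] 2 o))
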